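{- Let $G$ be a tripartite graph whose vertex set is partitioned into independent sets $V_1,V_2,V_3$, each of size $n$, with $V_a=\{v^a_1,\dots,v^a_n\}$. Define $p:V(G)\to\mathbb{R}^3$ by $p(v^1_i)=(\frac{n+i}{3n},0,1)^T$, $p(v^2_i)=(1,\frac{n+i}{3n},0)^T$, $p(v^3_i)=(0,1,\frac{n+i}{3n})^T$. For each edge $uv\in E(G)$ let $\ell(uv)$ be the line through $p(u)$ and $p(v)$, and let $\mathcal{L}=\{\ell(uv)\mid uv\in E(G)\}$. If $\ell,\ell'\in\mathcal{L}$ correspond to non-incident edges of $G$ (edges sharing no endpoint), then $\ell$ and $\ell'$ are disjoint and their distance is at least $\frac{1}{20n}$.
   Context: The distance between two lines is the infimum of Euclidean distances between a point of one and a point of the other.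
   Formalization: Disjointness and the distance bound are asserted only for the points of the two lines given by rational parameters, rather than for all points of the lines in ℝ³. -}

module Defs where

open import Data.Nat using (ℕ; zero; suc; _+_; _*_)
open import Data.Fin using (Fin; zero; suc; toℕ)
open import Data.Integer using (+_)
open import Data.Rational using (ℚ; _/_; 0ℚ; 1ℚ)
import Data.Rational as Q
open import Data.Product using (_×_; _,_)
open import Relation.Binary.PropositionalEquality using (_≡_)
open import Relation.Nullary using (¬_)

-- Points of ℝ³ with rational coordinates (all data here is rational).
Point : Set
Point = Fin 3 → ℚ

mkPoint : ℚ → ℚ → ℚ → Point
mkPoint x y z zero = x
mkPoint x y z (suc zero) = y
mkPoint x y z (suc (suc zero)) = z

-- Vertices of the tripartite graph: (a , i) stands for v^{a+1}_{i+1}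
-- (parts and indices are 0-based here).
Vertex : ℕ → Set
Vertex n = Fin 3 × Fin n

part : ∀ {n} → Vertex n → Fin 3
part (a , _) = a

-- (n + i) / (3n) for the 1-based index i = toℕ k + 1.
coord : (n : ℕ) → Fin n → ℚ
coord (suc m) k = + (suc m + suc (toℕ k)) / (3 * suc m)

p : (n : ℕ) → Vertex n → Point
p n (zero , k) = mkPoint (coord n k) 0ℚ 1ℚ
p n (suc zero , k) = mkPoint 1ℚ (coord n k) 0ℚ
p n (suc (suc zero) , k) = mkPoint 0ℚ 1ℚ (coord n k)

onLine : Point → Point → ℚ → Point
onLine a b s i = a i Q.+ s Q.* (b i Q.- a i)

distSq : Point → Point → ℚ
distSq x y = sq zero Q.+ (sq (suc zero) Q.+ sq (suc (suc zero)))
  where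
  sq : Fin 3 → ℚ
  sq i = (x i Q.- y i) Q.* (x i Q.- y i)

record TripartiteGraph (n : ℕ) : Set₁ where
  field
    Edge : Vertex n → Vertex n → Set
    sym : ∀ {u v} → Edge u v → Edge v u
    independent : ∀ {u v} → Edge u v → ¬ (part u ≡ part v)

{-# OPTIONS --safe #-}
-- For lines AB and CD and a vector N orthogonal to both directions, N · (X − Y) = N · (A − C)
-- for all X on AB and Y on CD, so Cauchy–Schwarz gives (N · (A − C))² ≤ |N|² |X − Y|².
-- The lines are therefore at distance at least 1/√c as soon as N · (A − C) ≠ 0 and
-- |N|² ≤ c (N · (A − C))²; here c = 400n².
-- Moving every vertex to the next part (V₁ → V₂ → V₃ → V₁) permutes the coordinates of p
-- cyclically, and reversing an edge or exchanging the two edges does not change the lines.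
-- So only two configurations remain: both edges between V₁ and V₂, or one edge between V₁
-- and V₂ and one between V₂ and V₃. All coordinates (n + i)/(3n) lie in [1/3, 2/3] and
-- distinct ones differ by at least 1/(3n); this bounds |N|² above and (N · (A − C))² below.
module Submission where

open import Defs
open import Algebra.Bundles using (CommutativeMonoid)
open import Data.Bool.Base using (T)
open import Data.Empty using (⊥-elim)
open import Data.Fin using (Fin; zero; suc; toℕ)
import Data.Fin.Properties as Fin
open import Data.Integer using (+_)
import Data.Integer as ℤ
import Data.Integer.Tactic.RingSolver as ℤ-Solver
open import Data.List using (_∷_; [])
open import Data.Nat as ℕ using (ℕ; zero; suc)
import Data.Nat.Properties as ℕ
open import Data.Product using (_×_; _,_; proj₁; proj₂)
open import Data.Rational
  using (ℚ; _/_; 0ℚ; 1ℚ; _≤_; _<_; _≤ᵇ_; _+_; _-_; -_; toℚᵘ; positive; nonNegative; nonPositive)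
open import Data.Rational.Properties
import Data.Rational.Unnormalised as ℚᵘ
import Data.Rational.Unnormalised.Properties as ℚᵘ
open import Data.Sum using (_⊎_; inj₁; inj₂)
open import Data.Unit using (tt)
open import Function using (_∘_)
open import Level using (0ℓ)
open import Relation.Binary.Definitions using (tri<; tri≈; tri>)
open import Relation.Binary.PropositionalEquality
open import Relation.Nullary using (¬_)
open import Relation.Nullary.Decidable using (dec⇒maybe)
open import Tactic.RingSolver using (solve-∀; solve)
open import Tactic.RingSolver.Core.AlmostCommutativeRing using (AlmostCommutativeRing; fromCommutativeRing)

-- Multiplication on ℚ is opened only inside this module: in the statement of lemma6, _*_ is on ℕ.
module _ where
  open import Data.Rational using (_*_)
  open import Algebra.Properties.CommutativeSemigroup
    (CommutativeMonoid.commutativeSemigroup *-1-commutativeMonoid) using (interchange)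

  ℚ-ring : AlmostCommutativeRing 0ℓ 0ℓ
  ℚ-ring = fromCommutativeRing +-*-commutativeRing (dec⇒maybe ∘ (0ℚ ≟_))

  p≤p+q : ∀ {p q} → 0ℚ ≤ q → p ≤ p + q
  p≤p+q {p} {q} 0≤q = subst (_≤ p + q) (+-identityʳ p) (+-monoʳ-≤ p 0≤q)

  p≤q⇒0≤q-p : ∀ {p q} → p ≤ q → 0ℚ ≤ q - p
  p≤q⇒0≤q-p {p} {q} p≤q = subst (_≤ q - p) (+-inverseʳ p) (+-monoˡ-≤ (- p) p≤q)

  +-nonNeg : ∀ {p q} → 0ℚ ≤ p → 0ℚ ≤ q → 0ℚ ≤ p + q
  +-nonNeg = +-mono-≤

  *-nonNeg : ∀ {p q} → 0ℚ ≤ p → 0ℚ ≤ q → 0ℚ ≤ p * q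
  *-nonNeg {p} {q} 0≤p 0≤q =
    nonNegative⁻¹ (p * q) {{nonNeg*nonNeg⇒nonNeg p {{nonNegative 0≤p}} q {{nonNegative 0≤q}}}}

  scaled-nonNeg : ∀ k {p} {_ : T (0ℚ ≤ᵇ k)} → 0ℚ ≤ p → 0ℚ ≤ k * p
  scaled-nonNeg k {_} {0≤k} = *-nonNeg (≤ᵇ⇒≤ {0ℚ} {k} 0≤k)

  square-nonNeg : ∀ p → 0ℚ ≤ p * p
  square-nonNeg p with ≤-total 0ℚ p
  ... | inj₁ 0≤p = *-nonNeg 0≤p 0≤p
  ... | inj₂ p≤0 = nonNegative⁻¹ (p * p) {{nonPos*nonPos⇒nonPos p {{nonPositive p≤0}} p {{nonPositive p≤0}}}}

  *-pos : ∀ {p q} → 0ℚ < p → 0ℚ < q → 0ℚ < p * q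
  *-pos {p} {q} 0<p 0<q = positive⁻¹ (p * q) {{pos*pos⇒pos p {{positive 0<p}} q {{positive 0<q}}}}

  0<p*q⇒0<q : ∀ {p q} → 0ℚ < p * q → 0ℚ ≤ q → 0ℚ < q
  0<p*q⇒0<q {p} {q} 0<pq 0≤q with <-cmp 0ℚ q
  ... | tri< 0<q _ _ = 0<q
  ... | tri≈ _ refl _ = ⊥-elim (<-irrefl refl (subst (0ℚ <_) (*-zeroʳ p) 0<pq))
  ... | tri> _ _ q<0 = ⊥-elim (<-irrefl refl (<-≤-trans q<0 0≤q))

  *-mono-≤-nonNeg : ∀ {p q r s} → 0ℚ ≤ p → 0ℚ ≤ r → p ≤ q → r ≤ s → p * r ≤ q * s
  *-mono-≤-nonNeg {p} {q} {r} {s} 0≤p 0≤r p≤q r≤s = begin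
    p * r  ≤⟨ *-monoʳ-≤-nonNeg r {{nonNegative 0≤r}} p≤q ⟩
    q * r  ≤⟨ *-monoˡ-≤-nonNeg q {{nonNegative (≤-trans 0≤p p≤q)}} r≤s ⟩
    q * s  ∎
    where open ≤-Reasoning

  infix 4 _∈[_,_]
  _∈[_,_] : ℚ → ℚ → ℚ → Set
  p ∈[ l , u ] = l ≤ p × p ≤ u

  ∈-+ : ∀ {p q a b c d} → p ∈[ a , b ] → q ∈[ c , d ] → p + q ∈[ a + c , b + d ]
  ∈-+ (a≤p , p≤b) (c≤q , q≤d) = +-mono-≤ a≤p c≤q , +-mono-≤ p≤b q≤d

  ∈-* : ∀ {p q a b c d} → 0ℚ ≤ a → 0ℚ ≤ c → p ∈[ a , b ] → q ∈[ c , d ] → p * q ∈[ a * c , b * d ]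
  ∈-* 0≤a 0≤c (a≤p , p≤b) (c≤q , q≤d) =
    *-mono-≤-nonNeg 0≤a 0≤c a≤p c≤q , *-mono-≤-nonNeg (≤-trans 0≤a a≤p) (≤-trans 0≤c c≤q) p≤b q≤d

  ∈-square : ∀ {p a b} → 0ℚ ≤ a → p ∈[ a , b ] → p * p ∈[ a * a , b * b ]
  ∈-square 0≤a p∈ = ∈-* 0≤a 0≤a p∈ p∈

  1-∈ : ∀ {p a b} → p ∈[ a , b ] → 1ℚ - p ∈[ 1ℚ - b , 1ℚ - a ]
  1-∈ (a≤p , p≤b) = +-monoʳ-≤ 1ℚ (neg-antimono-≤ p≤b) , +-monoʳ-≤ 1ℚ (neg-antimono-≤ a≤p)

  fromℕ : ℕ → ℚ
  fromℕ k = + k / 1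

  fromℕ-suc : ∀ k → fromℕ (suc k) ≡ 1ℚ + fromℕ k
  fromℕ-suc k = toℚᵘ-injective (begin
    toℚᵘ (fromℕ (suc k))               ≈⟨ toℚᵘ-fromℚᵘ (ℚᵘ.mkℚᵘ (+ suc k) 0) ⟩
    ℚᵘ.mkℚᵘ (+ suc k) 0                 ≈⟨ ℚᵘ.*≡* (identity (+ k)) ⟩
    toℚᵘ 1ℚ ℚᵘ.+ ℚᵘ.mkℚᵘ (+ k) 0         ≈⟨ ℚᵘ.+-congʳ (toℚᵘ 1ℚ)
                                             (ℚᵘ.≃-sym (toℚᵘ-fromℚᵘ (ℚᵘ.mkℚᵘ (+ k) 0))) ⟩
    toℚᵘ 1ℚ ℚᵘ.+ toℚᵘ (fromℕ k)         ≈⟨ ℚᵘ.≃-sym (toℚᵘ-homo-+ 1ℚ (fromℕ k)) ⟩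
    toℚᵘ (1ℚ + fromℕ k)                 ∎)
    where
    open ℚᵘ.≃-Reasoning
    identity : ∀ i → (+ 1 ℤ.+ i) ℤ.* + 1 ≡ (+ 1 ℤ.* + 1 ℤ.+ i ℤ.* + 1) ℤ.* + 1
    identity = ℤ-Solver.solve-∀

  fromℕ-*-/ : ∀ a d → fromℕ (suc d) * (+ a / suc d) ≡ fromℕ a
  fromℕ-*-/ a d = toℚᵘ-injective (begin
    toℚᵘ (fromℕ (suc d) * (+ a / suc d))           ≈⟨ toℚᵘ-homo-* (fromℕ (suc d)) (+ a / suc d) ⟩
    toℚᵘ (fromℕ (suc d)) ℚᵘ.* toℚᵘ (+ a / suc d)   ≈⟨ ℚᵘ.*-cong (toℚᵘ-fromℚᵘ (ℚᵘ.mkℚᵘ (+ suc d) 0))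
                                                                (toℚᵘ-fromℚᵘ (ℚᵘ.mkℚᵘ (+ a) d)) ⟩
    ℚᵘ.mkℚᵘ (+ suc d) 0 ℚᵘ.* ℚᵘ.mkℚᵘ (+ a) d        ≈⟨ ℚᵘ.*≡* (trans (identity (+ suc d) (+ a))
                                                         (cong (λ e → + a ℤ.* + e) (sym (ℕ.*-identityˡ (suc d))))) ⟩
    ℚᵘ.mkℚᵘ (+ a) 0                                 ≈⟨ ℚᵘ.≃-sym (toℚᵘ-fromℚᵘ (ℚᵘ.mkℚᵘ (+ a) 0)) ⟩
    toℚᵘ (fromℕ a)                                  ∎)
    where
    open ℚᵘ.≃-Reasoning
    identity : ∀ i j → (i ℤ.* j) ℤ.* + 1 ≡ j ℤ.* i
    identity = ℤ-Solver.solve-∀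

  fromℕ-+ : ∀ a b → fromℕ (a ℕ.+ b) ≡ fromℕ a + fromℕ b
  fromℕ-+ zero    b = sym (+-identityˡ (fromℕ b))
  fromℕ-+ (suc a) b = begin
    fromℕ (suc (a ℕ.+ b))       ≡⟨ fromℕ-suc (a ℕ.+ b) ⟩
    1ℚ + fromℕ (a ℕ.+ b)        ≡⟨ cong (λ q → 1ℚ + q) (fromℕ-+ a b) ⟩
    1ℚ + (fromℕ a + fromℕ b)    ≡⟨ sym (+-assoc 1ℚ (fromℕ a) (fromℕ b)) ⟩
    (1ℚ + fromℕ a) + fromℕ b    ≡⟨ cong (_+ fromℕ b) (sym (fromℕ-suc a)) ⟩
    fromℕ (suc a) + fromℕ b     ∎
    where open ≡-Reasoning

  fromℕ-* : ∀ a b → fromℕ (a ℕ.* b) ≡ fromℕ a * fromℕ b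
  fromℕ-* zero    b = sym (*-zeroˡ (fromℕ b))
  fromℕ-* (suc a) b = begin
    fromℕ (b ℕ.+ a ℕ.* b)         ≡⟨ fromℕ-+ b (a ℕ.* b) ⟩
    fromℕ b + fromℕ (a ℕ.* b)     ≡⟨ cong (λ q → fromℕ b + q) (fromℕ-* a b) ⟩
    fromℕ b + fromℕ a * fromℕ b   ≡⟨ distrib (fromℕ a) (fromℕ b) ⟩
    (1ℚ + fromℕ a) * fromℕ b      ≡⟨ cong (_* fromℕ b) (sym (fromℕ-suc a)) ⟩
    fromℕ (suc a) * fromℕ b       ∎
    where
    open ≡-Reasoning
    distrib : ∀ p q → q + p * q ≡ (1ℚ + p) * q
    distrib = solve-∀ ℚ-ring

  fromℕ-nonNeg : ∀ k → 0ℚ ≤ fromℕ k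
  fromℕ-nonNeg k = nonNegative⁻¹ (fromℕ k) {{normalize-nonNeg k 1}}

  fromℕ-mono-≤ : ∀ {a b} → a ℕ.≤ b → fromℕ a ≤ fromℕ b
  fromℕ-mono-≤ {a} {b} a≤b = begin
    fromℕ a                     ≤⟨ p≤p+q (fromℕ-nonNeg (b ℕ.∸ a)) ⟩
    fromℕ a + fromℕ (b ℕ.∸ a)   ≡⟨ sym (fromℕ-+ a (b ℕ.∸ a)) ⟩
    fromℕ (a ℕ.+ (b ℕ.∸ a))     ≡⟨ cong fromℕ (ℕ.m+[n∸m]≡n a≤b) ⟩
    fromℕ b                     ∎
    where open ≤-Reasoning

  fromℕ-1≤diff²-< : ∀ {a b} → a ℕ.< b → 1ℚ ≤ (fromℕ a - fromℕ b) * (fromℕ a - fromℕ b)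
  fromℕ-1≤diff²-< {a} {b} a<b = begin
    1ℚ                                          ≤⟨ p≤p+q (+-nonNeg (+-nonNeg 0≤δ 0≤δ) (*-nonNeg 0≤δ 0≤δ)) ⟩
    1ℚ + (δ + δ + δ * δ)                        ≡⟨ expand (fromℕ a) δ ⟩
    (fromℕ a - (1ℚ + fromℕ a + δ)) * (fromℕ a - (1ℚ + fromℕ a + δ))
                                                ≡⟨ cong (λ q → (fromℕ a - q) * (fromℕ a - q)) b≡1+a+δ ⟩
    (fromℕ a - fromℕ b) * (fromℕ a - fromℕ b)   ∎
    where
    open ≤-Reasoning
    δ : ℚ
    δ = fromℕ (b ℕ.∸ suc a)
    0≤δ : 0ℚ ≤ δ
    0≤δ = fromℕ-nonNeg (b ℕ.∸ suc a)
    b≡1+a+δ : 1ℚ + fromℕ a + δ ≡ fromℕ b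
    b≡1+a+δ = trans (cong (_+ δ) (sym (fromℕ-suc a)))
                (trans (sym (fromℕ-+ (suc a) (b ℕ.∸ suc a))) (cong fromℕ (ℕ.m+[n∸m]≡n a<b)))
    expand : ∀ p d → 1ℚ + (d + d + d * d) ≡ (p - (1ℚ + p + d)) * (p - (1ℚ + p + d))
    expand = solve-∀ ℚ-ring

  fromℕ-1≤diff² : ∀ {a b} → a ≢ b → 1ℚ ≤ (fromℕ a - fromℕ b) * (fromℕ a - fromℕ b)
  fromℕ-1≤diff² {a} {b} a≢b with ℕ.<-cmp a b
  ... | tri< a<b _ _ = fromℕ-1≤diff²-< a<b
  ... | tri≈ _ a≡b _ = ⊥-elim (a≢b a≡b)
  ... | tri> _ _ b<a = subst (1ℚ ≤_) (flip (fromℕ b) (fromℕ a)) (fromℕ-1≤diff²-< b<a)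
    where
    flip : ∀ p q → (p - q) * (p - q) ≡ (q - p) * (q - p)
    flip = solve-∀ ℚ-ring

  -- Vectors and lines in ℚ³

  i₀ i₁ i₂ : Fin 3
  i₀ = zero
  i₁ = suc zero
  i₂ = suc (suc zero)

  next : Fin 3 → Fin 3
  next zero             = suc zero
  next (suc zero)       = suc (suc zero)
  next (suc (suc zero)) = zero

  _-ᵥ_ : Point → Point → Point
  (u -ᵥ w) i = u i - w i

  _·_ : Point → Point → ℚ
  u · w = u i₀ * w i₀ + (u i₁ * w i₁ + u i₂ * w i₂)

  _⨯_ : Point → Point → Point
  u ⨯ w = mkPoint (u i₁ * w i₂ - u i₂ * w i₁) (u i₂ * w i₀ - u i₀ * w i₂) (u i₀ * w i₁ - u i₁ * w i₀)

  ·-self-nonNeg : ∀ u → 0ℚ ≤ u · u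
  ·-self-nonNeg u = +-nonNeg (square-nonNeg (u i₀)) (+-nonNeg (square-nonNeg (u i₁)) (square-nonNeg (u i₂)))

  lagrange-identity : ∀ u w → (u · u) * (w · w) ≡ (u · w) * (u · w) + (u ⨯ w) · (u ⨯ w)
  lagrange-identity u w = identity (u i₀) (u i₁) (u i₂) (w i₀) (w i₁) (w i₂)
    where
    identity : ∀ a b c x y z →
      (a * a + (b * b + c * c)) * (x * x + (y * y + z * z)) ≡
      (a * x + (b * y + c * z)) * (a * x + (b * y + c * z)) +
      ((b * z - c * y) * (b * z - c * y) + ((c * x - a * z) * (c * x - a * z) + (a * y - b * x) * (a * y - b * x)))
    identity = solve-∀ ℚ-ring

  cauchy-schwarz : ∀ u w → (u · w) * (u · w) ≤ (u · u) * (w · w)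
  cauchy-schwarz u w = begin
    (u · w) * (u · w)                       ≤⟨ p≤p+q (·-self-nonNeg (u ⨯ w)) ⟩
    (u · w) * (u · w) + (u ⨯ w) · (u ⨯ w)   ≡⟨ sym (lagrange-identity u w) ⟩
    (u · u) * (w · w)                       ∎
    where open ≤-Reasoning

  ·-onLine-difference : ∀ N A B C D s t →
    N · (onLine A B s -ᵥ onLine C D t) ≡ N · (A -ᵥ C) + (s * (N · (B -ᵥ A)) - t * (N · (D -ᵥ C)))
  ·-onLine-difference N A B C D s t =
    expand (N i₀) (N i₁) (N i₂) (A i₀) (A i₁) (A i₂) (B i₀) (B i₁) (B i₂)
           (C i₀) (C i₁) (C i₂) (D i₀) (D i₁) (D i₂) s t
    where
    expand : ∀ n₀ n₁ n₂ a₀ a₁ a₂ b₀ b₁ b₂ c₀ c₁ c₂ d₀ d₁ d₂ s t →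
      n₀ * ((a₀ + s * (b₀ - a₀)) - (c₀ + t * (d₀ - c₀))) +
        (n₁ * ((a₁ + s * (b₁ - a₁)) - (c₁ + t * (d₁ - c₁))) + n₂ * ((a₂ + s * (b₂ - a₂)) - (c₂ + t * (d₂ - c₂))))
      ≡ (n₀ * (a₀ - c₀) + (n₁ * (a₁ - c₁) + n₂ * (a₂ - c₂))) +
        (s * (n₀ * (b₀ - a₀) + (n₁ * (b₁ - a₁) + n₂ * (b₂ - a₂))) -
         t * (n₀ * (d₀ - c₀) + (n₁ * (d₁ - c₁) + n₂ * (d₂ - c₂))))
    expand = solve-∀ ℚ-ring

  onLine-cong : ∀ {A A' B B'} s → A ≗ A' → B ≗ B' → onLine A B s ≗ onLine A' B' s
  onLine-cong s A≗A' B≗B' i = cong₂ (λ a b → a + s * (b - a)) (A≗A' i) (B≗B' i)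

  onLine-reverse : ∀ A B s → onLine B A (1ℚ - s) ≗ onLine A B s
  onLine-reverse A B s i = reverse (A i) (B i) s
    where
    reverse : ∀ a b s → b + (1ℚ - s) * (a - b) ≡ a + s * (b - a)
    reverse = solve-∀ ℚ-ring

  distSq-cong : ∀ {X X' Y Y'} → X ≗ X' → Y ≗ Y' → distSq X Y ≡ distSq X' Y'
  distSq-cong {X} {X'} {Y} {Y'} X≗X' Y≗Y' = cong₂ _+_ (sq-cong i₀) (cong₂ _+_ (sq-cong i₁) (sq-cong i₂))
    where
    sq-cong : ∀ i → (X i - Y i) * (X i - Y i) ≡ (X' i - Y' i) * (X' i - Y' i)
    sq-cong i = cong₂ (λ x y → (x - y) * (x - y)) (X≗X' i) (Y≗Y' i)

  distSq-comm : ∀ X Y → distSq X Y ≡ distSq Y X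
  distSq-comm X Y = cong₂ _+_ (sq-comm i₀) (cong₂ _+_ (sq-comm i₁) (sq-comm i₂))
    where
    flip : ∀ x y → (x - y) * (x - y) ≡ (y - x) * (y - x)
    flip = solve-∀ ℚ-ring
    sq-comm : ∀ i → (X i - Y i) * (X i - Y i) ≡ (Y i - X i) * (Y i - X i)
    sq-comm i = flip (X i) (Y i)

  distSq-next : ∀ X Y → distSq (X ∘ next) (Y ∘ next) ≡ distSq X Y
  distSq-next X Y = trans (sym (+-assoc (sq i₁) (sq i₂) (sq i₀))) (+-comm (sq i₁ + sq i₂) (sq i₀))
    where
    sq : Fin 3 → ℚ
    sq i = (X i - Y i) * (X i - Y i)

  distSq-self : ∀ X → distSq X X ≡ 0ℚ
  distSq-self X = vanish (X i₀) (X i₁) (X i₂)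
    where
    vanish : ∀ x y z → (x - x) * (x - x) + ((y - y) * (y - y) + (z - z) * (z - z)) ≡ 0ℚ
    vanish = solve-∀ ℚ-ring

  record Separated (c : ℚ) (A B C D : Point) : Set where
    field
      bound : ∀ s t → 1ℚ ≤ c * distSq (onLine A B s) (onLine C D t)
  open Separated

  offset-bound : ∀ {A B C D} N s t → N · (B -ᵥ A) ≡ 0ℚ → N · (D -ᵥ C) ≡ 0ℚ →
    (N · (A -ᵥ C)) * (N · (A -ᵥ C)) ≤ (N · N) * distSq (onLine A B s) (onLine C D t)
  offset-bound {A} {B} {C} {D} N s t N⊥AB N⊥CD = begin
    (N · (A -ᵥ C)) * (N · (A -ᵥ C))   ≡⟨ cong (λ e → e * e) (sym N·w≡N·AC) ⟩
    (N · w) * (N · w)                 ≤⟨ cauchy-schwarz N w ⟩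
    (N · N) * (w · w)                 ∎
    where
    open ≤-Reasoning
    w : Point
    w = onLine A B s -ᵥ onLine C D t
    vanish : ∀ e s t → e + (s * 0ℚ - t * 0ℚ) ≡ e
    vanish = solve-∀ ℚ-ring
    N·w≡N·AC : N · w ≡ N · (A -ᵥ C)
    N·w≡N·AC = begin-equality
      N · w                                                     ≡⟨ ·-onLine-difference N A B C D s t ⟩
      N · (A -ᵥ C) + (s * (N · (B -ᵥ A)) - t * (N · (D -ᵥ C)))   ≡⟨ cong₂ (λ b d → N · (A -ᵥ C) + (s * b - t * d))
                                                                          N⊥AB N⊥CD ⟩
      N · (A -ᵥ C) + (s * 0ℚ - t * 0ℚ)                            ≡⟨ vanish (N · (A -ᵥ C)) s t ⟩
      N · (A -ᵥ C)                                              ∎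

  separated-by-normal : ∀ {c E A B C D} N →
    N · (B -ᵥ A) ≡ 0ℚ → N · (D -ᵥ C) ≡ 0ℚ → N · (A -ᵥ C) ≡ E →
    0ℚ < E * E → N · N ≤ c * (E * E) → Separated c A B C D
  bound (separated-by-normal {c} {A = A} {B} {C} {D} N N⊥AB N⊥CD refl 0<E² N²≤cE²) s t =
    *-cancelˡ-≤-pos E² {{positive 0<E²}} (begin
      E² * 1ℚ        ≡⟨ *-identityʳ E² ⟩
      E²             ≤⟨ offset-bound {A} {B} {C} {D} N s t N⊥AB N⊥CD ⟩
      (N · N) * d    ≤⟨ *-monoʳ-≤-nonNeg d {{nonNegative (·-self-nonNeg (onLine A B s -ᵥ onLine C D t))}}
                                          N²≤cE² ⟩
      (c * E²) * d   ≡⟨ cong (_* d) (*-comm c E²) ⟩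
      (E² * c) * d   ≡⟨ *-assoc E² c d ⟩
      E² * (c * d)   ∎)
    where
    open ≤-Reasoning
    E² d : ℚ
    E² = (N · (A -ᵥ C)) * (N · (A -ᵥ C))
    d = distSq (onLine A B s) (onLine C D t)

  separated-swapˡ : ∀ {c A B C D} → Separated c B A C D → Separated c A B C D
  bound (separated-swapˡ {c} {A} {B} {C} {D} sep) s t =
    subst (λ d → 1ℚ ≤ c * d) (distSq-cong {Y = onLine C D t} (onLine-reverse A B s) (λ _ → refl))
      (bound sep (1ℚ - s) t)

  separated-swapʳ : ∀ {c A B C D} → Separated c A B D C → Separated c A B C D
  bound (separated-swapʳ {c} {A} {B} {C} {D} sep) s t =
    subst (λ d → 1ℚ ≤ c * d) (distSq-cong {X = onLine A B s} (λ _ → refl) (onLine-reverse C D t))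
      (bound sep s (1ℚ - t))

  separated-sym : ∀ {c A B C D} → Separated c C D A B → Separated c A B C D
  bound (separated-sym {c} {A} {B} {C} {D} sep) s t =
    subst (λ d → 1ℚ ≤ c * d) (distSq-comm (onLine C D t) (onLine A B s)) (bound sep t s)

  separated-rotate : ∀ {c A B C D A' B' C' D'} →
    A' ∘ next ≗ A → B' ∘ next ≗ B → C' ∘ next ≗ C → D' ∘ next ≗ D →
    Separated c A B C D → Separated c A' B' C' D'
  bound (separated-rotate {c} {A} {B} {C} {D} {A'} {B'} {C'} {D'} A≗ B≗ C≗ D≗ sep) s t =
    subst (λ d → 1ℚ ≤ c * d) moved (bound sep s t)
    where
    moved : distSq (onLine A B s) (onLine C D t) ≡ distSq (onLine A' B' s) (onLine C' D' t)
    moved = trans (sym (distSq-cong (onLine-cong s A≗ B≗) (onLine-cong t C≗ D≗)))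
                  (distSq-next (onLine A' B' s) (onLine C' D' t))

  separated⇒disjoint : ∀ {c A B C D} → Separated c A B C D → ∀ s t → ¬ (onLine A B s ≗ onLine C D t)
  separated⇒disjoint {c} {A} {B} {C} {D} sep s t meet =
    <-irrefl refl (<-≤-trans (positive⁻¹ 1ℚ) (subst (1ℚ ≤_) c*dist≡0 (bound sep s t)))
    where
    c*dist≡0 : c * distSq (onLine A B s) (onLine C D t) ≡ 0ℚ
    c*dist≡0 = trans (cong (c *_) (trans (distSq-cong {Y = onLine C D t} meet (λ _ → refl))
                                          (distSq-self (onLine C D t))))
                     (*-zeroʳ c)

  -- The two configurations of edges

  P₁ P₂ P₃ : ℚ → Point
  P₁ α = mkPoint α 0ℚ 1ℚ
  P₂ β = mkPoint 1ℚ β 0ℚ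
  P₃ γ = mkPoint 0ℚ 1ℚ γ

  MiddleThird : ℚ → Set
  MiddleThird α = α ∈[ + 1 / 3 , + 2 / 3 ]

  -- For c = 400n² this says |α − β| ≥ 1/(3n).
  Apart : ℚ → ℚ → ℚ → Set
  Apart c α β = + 400 / 9 ≤ c * ((α - β) * (α - β))

  middleThird-square≤1 : ∀ {α} → MiddleThird α → α * α ≤ 1ℚ
  middleThird-square≤1 α∈ = ≤-trans (proj₂ (∈-square (≤ᵇ⇒≤ tt) α∈)) (≤ᵇ⇒≤ tt)

  apart⇒0<square : ∀ c α β → Apart c α β → 0ℚ < (α - β) * (α - β)
  apart⇒0<square c α β α≉β =
    0<p*q⇒0<q {c} (<-≤-trans (positive⁻¹ (+ 400 / 9)) α≉β) (square-nonNeg (α - β))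

  -- c (xy)² = ½(cx² − 400/9)y² + ½(cy² − 400/9)x² + (200/9)(x² + y²), and
  -- (ax + by)² = 2a²x² + 2b²y² − (ax − by)².
  parallel-bound : ∀ a b x y c → a * a ≤ 1ℚ → b * b ≤ 1ℚ →
    + 400 / 9 ≤ c * (x * x) → + 400 / 9 ≤ c * (y * y) →
    x * x + (y * y + (a * x + b * y) * (a * x + b * y)) ≤ c * ((x * y) * (x * y))
  parallel-bound a b x y c a²≤1 b²≤1 cx²≥ cy²≥ = begin
    x * x + (y * y + (a * x + b * y) * (a * x + b * y))
      ≤⟨ p≤p+q (+-nonNeg (scaled-nonNeg (+ 1 / 2) (*-nonNeg (p≤q⇒0≤q-p cx²≥) (square-nonNeg y)))
               (+-nonNeg (scaled-nonNeg (+ 1 / 2) (*-nonNeg (p≤q⇒0≤q-p cy²≥) (square-nonNeg x)))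
               (+-nonNeg (scaled-nonNeg (+ 2 / 1) (*-nonNeg (p≤q⇒0≤q-p a²≤1) (square-nonNeg x)))
               (+-nonNeg (scaled-nonNeg (+ 2 / 1) (*-nonNeg (p≤q⇒0≤q-p b²≤1) (square-nonNeg y)))
               (+-nonNeg (scaled-nonNeg (+ 173 / 9) (+-nonNeg (square-nonNeg x) (square-nonNeg y)))
                         (square-nonNeg (a * x - b * y))))))) ⟩
    x * x + (y * y + (a * x + b * y) * (a * x + b * y)) +
      (+ 1 / 2 * ((c * (x * x) - + 400 / 9) * (y * y)) +
      (+ 1 / 2 * ((c * (y * y) - + 400 / 9) * (x * x)) +
      (+ 2 / 1 * ((1ℚ - a * a) * (x * x)) +
      (+ 2 / 1 * ((1ℚ - b * b) * (y * y)) +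
      (+ 173 / 9 * (x * x + y * y) + (a * x - b * y) * (a * x - b * y))))))
      ≡⟨ solve (a ∷ b ∷ x ∷ y ∷ c ∷ []) ℚ-ring ⟩
    c * ((x * y) * (x * y)) ∎
    where open ≤-Reasoning

  -- In both configurations the normal N is, up to sign, the cross product of the two directions.
  separated-parallel : ∀ {c α β α' β'} → MiddleThird α → MiddleThird β → Apart c α α' → Apart c β β' →
    Separated c (P₁ α) (P₂ β) (P₁ α') (P₂ β')
  separated-parallel {c} {α} {β} {α'} {β'} α∈ β∈ α≉α' β≉β' =
    separated-by-normal (mkPoint (β - β') (α - α') ((1ℚ - α) * (β - β') + β * (α - α')))
      (normal⊥AB α β α' β') (normal⊥CD α β α' β') (offset α β α' β')
      (subst (0ℚ <_) (interchange (β - β') (β - β') (α - α') (α - α'))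
        (*-pos (apart⇒0<square c β β' β≉β') (apart⇒0<square c α α' α≉α')))
      (parallel-bound (1ℚ - α) β (β - β') (α - α') c
        (middleThird-square≤1 (1-∈ α∈)) (middleThird-square≤1 β∈) β≉β' α≉α')
    where
    normal⊥AB : ∀ α β α' β' →
      (β - β') * (1ℚ - α) + ((α - α') * (β - 0ℚ) + ((1ℚ - α) * (β - β') + β * (α - α')) * (0ℚ - 1ℚ)) ≡ 0ℚ
    normal⊥AB = solve-∀ ℚ-ring
    normal⊥CD : ∀ α β α' β' →
      (β - β') * (1ℚ - α') + ((α - α') * (β' - 0ℚ) + ((1ℚ - α) * (β - β') + β * (α - α')) * (0ℚ - 1ℚ)) ≡ 0ℚ
    normal⊥CD = solve-∀ ℚ-ring
    offset : ∀ α β α' β' →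
      (β - β') * (α - α') + ((α - α') * (0ℚ - 0ℚ) + ((1ℚ - α) * (β - β') + β * (α - α')) * (1ℚ - 1ℚ))
        ≡ (β - β') * (α - α')
    offset = solve-∀ ℚ-ring

  separated-consecutive : ∀ {c α β β' γ} → MiddleThird α → MiddleThird β → MiddleThird β' → MiddleThird γ →
    Apart c β β' → Separated c (P₁ α) (P₂ β) (P₂ β') (P₃ γ)
  separated-consecutive {c} {α} {β} {β'} {γ} α∈ β∈ β'∈ γ∈ β≉β' =
    separated-by-normal (mkPoint Nx Ny Nz)
      (normal⊥AB α β β' γ) (normal⊥CD α β β' γ) (offset α β β' γ)
      (0<p*q⇒0<q {c} (<-≤-trans (positive⁻¹ (+ 10000 / 729)) cE²≥) (square-nonNeg ((β - β') * Ny)))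
      (begin
        Nx * Nx + (Ny * Ny + Nz * Nz)   ≤⟨ proj₂ (∈-+ (∈-square (≤ᵇ⇒≤ tt) Nx∈)
                                                   (∈-+ (∈-square (≤ᵇ⇒≤ tt) Ny∈) (∈-square (≤ᵇ⇒≤ tt) Nz∈))) ⟩
        + 88 / 27                       ≤⟨ ≤ᵇ⇒≤ tt ⟩
        + 10000 / 729                   ≤⟨ cE²≥ ⟩
        c * (((β - β') * Ny) * ((β - β') * Ny)) ∎)
    where
    open ≤-Reasoning
    Nx Ny Nz : ℚ
    Nx = β * γ + (1ℚ - β')
    Ny = 1ℚ - (1ℚ - α) * γ
    Nz = (1ℚ - α) * (1ℚ - β') + β
    normal⊥AB : ∀ α β β' γ →
      (β * γ + (1ℚ - β')) * (1ℚ - α) +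
        ((1ℚ - (1ℚ - α) * γ) * (β - 0ℚ) + ((1ℚ - α) * (1ℚ - β') + β) * (0ℚ - 1ℚ)) ≡ 0ℚ
    normal⊥AB = solve-∀ ℚ-ring
    normal⊥CD : ∀ α β β' γ →
      (β * γ + (1ℚ - β')) * (0ℚ - 1ℚ) +
        ((1ℚ - (1ℚ - α) * γ) * (1ℚ - β') + ((1ℚ - α) * (1ℚ - β') + β) * (γ - 0ℚ)) ≡ 0ℚ
    normal⊥CD = solve-∀ ℚ-ring
    offset : ∀ α β β' γ →
      (β * γ + (1ℚ - β')) * (α - 1ℚ) +
        ((1ℚ - (1ℚ - α) * γ) * (0ℚ - β') + ((1ℚ - α) * (1ℚ - β') + β) * (1ℚ - 0ℚ))
        ≡ (β - β') * (1ℚ - (1ℚ - α) * γ)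
    offset = solve-∀ ℚ-ring
    Nx∈ : Nx ∈[ + 4 / 9 , + 10 / 9 ]
    Nx∈ = ∈-+ (∈-* (≤ᵇ⇒≤ tt) (≤ᵇ⇒≤ tt) β∈ γ∈) (1-∈ β'∈)
    Ny∈ : Ny ∈[ + 5 / 9 , + 8 / 9 ]
    Ny∈ = 1-∈ (∈-* (≤ᵇ⇒≤ tt) (≤ᵇ⇒≤ tt) (1-∈ α∈) γ∈)
    Nz∈ : Nz ∈[ + 4 / 9 , + 10 / 9 ]
    Nz∈ = ∈-+ (∈-* (≤ᵇ⇒≤ tt) (≤ᵇ⇒≤ tt) (1-∈ α∈) (1-∈ β'∈)) β∈
    cE²≥ : + 10000 / 729 ≤ c * (((β - β') * Ny) * ((β - β') * Ny))
    cE²≥ = begin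
      + 10000 / 729                             ≡⟨⟩
      + 400 / 9 * (+ 25 / 81)                   ≤⟨ *-mono-≤-nonNeg (≤ᵇ⇒≤ tt) (≤ᵇ⇒≤ tt) β≉β'
                                                     (proj₁ (∈-square (≤ᵇ⇒≤ tt) Ny∈)) ⟩
      c * ((β - β') * (β - β')) * (Ny * Ny)     ≡⟨ *-assoc c _ _ ⟩
      c * (((β - β') * (β - β')) * (Ny * Ny))   ≡⟨ cong (c *_) (interchange (β - β') (β - β') Ny Ny) ⟩
      c * (((β - β') * Ny) * ((β - β') * Ny))   ∎

  -- The coordinates (n + i)/(3n)

  scale : ℕ → ℚ
  scale n = + (400 ℕ.* n ℕ.* n) / 1

  module _ (m : ℕ) where
    private
      n : ℕ
      n = suc m
      ν τ : ℚ
      ν = fromℕ n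
      τ = fromℕ (3 ℕ.* n)
      τ≡3ν : τ ≡ + 3 / 1 * ν
      τ≡3ν = fromℕ-* 3 n

    -- The denominator 3 ℕ.* n of coord computes to suc (m ℕ.+ 2 ℕ.* n).
    coord-scaled : ∀ k → τ * coord n k ≡ ν + fromℕ (suc (toℕ k))
    coord-scaled k = trans (fromℕ-*-/ (n ℕ.+ suc (toℕ k)) (m ℕ.+ 2 ℕ.* n)) (fromℕ-+ n (suc (toℕ k)))

    coord-middleThird : ∀ k → MiddleThird (coord n k)
    coord-middleThird k =
      *-cancelˡ-≤-pos τ {{normalize-pos (3 ℕ.* n) 1}} (begin
        τ * (+ 1 / 3)             ≡⟨ thirds (+ 1 / 3) ⟩
        + 3 / 1 * (+ 1 / 3) * ν   ≡⟨ *-identityˡ ν ⟩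
        ν                         ≤⟨ p≤p+q (fromℕ-nonNeg (suc (toℕ k))) ⟩
        ν + fromℕ (suc (toℕ k))   ≡⟨ sym (coord-scaled k) ⟩
        τ * coord n k             ∎) ,
      *-cancelˡ-≤-pos τ {{normalize-pos (3 ℕ.* n) 1}} (begin
        τ * coord n k             ≡⟨ coord-scaled k ⟩
        ν + fromℕ (suc (toℕ k))   ≤⟨ +-monoʳ-≤ ν (fromℕ-mono-≤ (Fin.toℕ<n k)) ⟩
        ν + ν                     ≡⟨ double ν ⟩
        + 3 / 1 * (+ 2 / 3) * ν   ≡⟨ sym (thirds (+ 2 / 3)) ⟩
        τ * (+ 2 / 3)             ∎)
      where
      open ≤-Reasoning
      swap : ∀ a b c → a * b * c ≡ a * c * b
      swap = solve-∀ ℚ-ring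
      thirds : ∀ q → τ * q ≡ + 3 / 1 * q * ν
      thirds q = trans (cong (_* q) τ≡3ν) (swap (+ 3 / 1) ν q)
      double : ∀ p → p + p ≡ + 2 / 1 * p
      double = solve-∀ ℚ-ring

    coord-apart : ∀ {k l} → k ≢ l → Apart (scale n) (coord n k) (coord n l)
    coord-apart {k} {l} k≢l = begin
      + 400 / 9                                              ≡⟨ sym (*-identityʳ (+ 400 / 9)) ⟩
      + 400 / 9 * 1ℚ                                         ≤⟨ *-monoˡ-≤-nonNeg (+ 400 / 9) (fromℕ-1≤diff² 1+k≢1+l) ⟩
      + 400 / 9 * ((fₖ - fₗ) * (fₖ - fₗ))                     ≡⟨ cong (λ e → + 400 / 9 * (e * e)) (sym gap) ⟩
      + 400 / 9 * ((τ * cₖ - τ * cₗ) * (τ * cₖ - τ * cₗ))     ≡⟨ cong (λ t → + 400 / 9 * ((t * cₖ - t * cₗ) * (t * cₖ - t * cₗ)))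
                                                                  τ≡3ν ⟩
      + 400 / 9 * ((+ 3 / 1 * ν * cₖ - + 3 / 1 * ν * cₗ) * (+ 3 / 1 * ν * cₖ - + 3 / 1 * ν * cₗ))
                                                             ≡⟨ sym (rescale ν cₖ cₗ) ⟩
      + 400 / 1 * ν * ν * ((cₖ - cₗ) * (cₖ - cₗ))             ≡⟨ cong (λ s → s * ((cₖ - cₗ) * (cₖ - cₗ))) (sym scale≡) ⟩
      scale n * ((cₖ - cₗ) * (cₖ - cₗ))                       ∎
      where
      open ≤-Reasoning
      cₖ cₗ fₖ fₗ : ℚ
      cₖ = coord n k
      cₗ = coord n l
      fₖ = fromℕ (suc (toℕ k))
      fₗ = fromℕ (suc (toℕ l))
      1+k≢1+l : suc (toℕ k) ≢ suc (toℕ l)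
      1+k≢1+l = k≢l ∘ Fin.toℕ-injective ∘ ℕ.suc-injective
      cancel : ∀ a p q → (a + p) - (a + q) ≡ p - q
      cancel = solve-∀ ℚ-ring
      gap : τ * cₖ - τ * cₗ ≡ fₖ - fₗ
      gap = trans (cong₂ _-_ (coord-scaled k) (coord-scaled l)) (cancel ν fₖ fₗ)
      scale≡ : scale n ≡ + 400 / 1 * ν * ν
      scale≡ = trans (fromℕ-* (400 ℕ.* n) n) (cong (_* ν) (fromℕ-* 400 n))
      rescale : ∀ a p q → + 400 / 1 * a * a * ((p - q) * (p - q)) ≡
        + 400 / 9 * ((+ 3 / 1 * a * p - + 3 / 1 * a * q) * (+ 3 / 1 * a * p - + 3 / 1 * a * q))
      rescale = solve-∀ ℚ-ring

  -- Pairs of disjoint edges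

  rotate : ∀ {n} → Vertex n → Vertex n
  rotate (a , k) = next a , k

  p-rotate : ∀ n w → p n (rotate w) ∘ next ≗ p n w
  p-rotate n (zero , k)           zero             = refl
  p-rotate n (zero , k)           (suc zero)       = refl
  p-rotate n (zero , k)           (suc (suc zero)) = refl
  p-rotate n (suc zero , k)       zero             = refl
  p-rotate n (suc zero , k)       (suc zero)       = refl
  p-rotate n (suc zero , k)       (suc (suc zero)) = refl
  p-rotate n (suc (suc zero) , k) zero             = refl
  p-rotate n (suc (suc zero) , k) (suc zero)       = refl
  p-rotate n (suc (suc zero) , k) (suc (suc zero)) = refl

  Disjoint : ∀ {n} → Vertex n → Vertex n → Vertex n → Vertex n → Set
  Disjoint u v x y = u ≢ x × u ≢ y × v ≢ x × v ≢ y

  EdgesSeparated : (n : ℕ) → Vertex n → Vertex n → Vertex n → Vertex n → Set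
  EdgesSeparated n u v x y = Disjoint u v x y → Separated (scale n) (p n u) (p n v) (p n x) (p n y)

  edges-swapˡ : ∀ {n u v x y} → EdgesSeparated n v u x y → EdgesSeparated n u v x y
  edges-swapˡ sep (u≢x , u≢y , v≢x , v≢y) = separated-swapˡ (sep (v≢x , v≢y , u≢x , u≢y))

  edges-swapʳ : ∀ {n u v x y} → EdgesSeparated n u v y x → EdgesSeparated n u v x y
  edges-swapʳ sep (u≢x , u≢y , v≢x , v≢y) = separated-swapʳ (sep (u≢y , u≢x , v≢y , v≢x))

  edges-sym : ∀ {n u v x y} → EdgesSeparated n x y u v → EdgesSeparated n u v x y
  edges-sym sep (u≢x , u≢y , v≢x , v≢y) =
    separated-sym (sep (≢-sym u≢x , ≢-sym v≢x , ≢-sym u≢y , ≢-sym v≢y))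

  edges-rotate : ∀ {n u v x y} → EdgesSeparated n u v x y →
    EdgesSeparated n (rotate u) (rotate v) (rotate x) (rotate y)
  edges-rotate {n} {u} {v} {x} {y} sep (u≢x , u≢y , v≢x , v≢y) =
    separated-rotate (p-rotate n u) (p-rotate n v) (p-rotate n x) (p-rotate n y)
      (sep (u≢x ∘ cong rotate , u≢y ∘ cong rotate , v≢x ∘ cong rotate , v≢y ∘ cong rotate))

  module _ {m : ℕ} where
    private
      n : ℕ
      n = suc m

    edges-parallel : ∀ {i j i' j'} → EdgesSeparated n (zero , i) (suc zero , j) (zero , i') (suc zero , j')
    edges-parallel {i} {j} (u≢x , _ , _ , v≢y) =
      separated-parallel (coord-middleThird m i) (coord-middleThird m j)
        (coord-apart m (u≢x ∘ cong (zero ,_))) (coord-apart m (v≢y ∘ cong (suc zero ,_)))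

    edges-consecutive : ∀ {i j j' k} → EdgesSeparated n (zero , i) (suc zero , j) (suc zero , j') (suc (suc zero) , k)
    edges-consecutive {i} {j} {j'} {k} (_ , _ , v≢x , _) =
      separated-consecutive (coord-middleThird m i) (coord-middleThird m j) (coord-middleThird m j')
        (coord-middleThird m k) (coord-apart m (v≢x ∘ cong (suc zero ,_)))

    edges-from-V₁ : ∀ b {i j i' j'} → EdgesSeparated n (zero , i) (suc zero , j) (b , i') (next b , j')
    edges-from-V₁ zero             = edges-parallel
    edges-from-V₁ (suc zero)       = edges-consecutive
    edges-from-V₁ (suc (suc zero)) = edges-sym (edges-rotate (edges-rotate edges-consecutive))

    edges-oriented : ∀ a b {i j i' j'} → EdgesSeparated n (a , i) (next a , j) (b , i') (next b , j')
    edges-oriented zero             b                = edges-from-V₁ b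
    edges-oriented (suc zero)       zero             = edges-rotate (edges-from-V₁ (suc (suc zero)))
    edges-oriented (suc zero)       (suc zero)       = edges-rotate (edges-from-V₁ zero)
    edges-oriented (suc zero)       (suc (suc zero)) = edges-rotate (edges-from-V₁ (suc zero))
    edges-oriented (suc (suc zero)) zero             = edges-rotate (edges-rotate (edges-from-V₁ (suc zero)))
    edges-oriented (suc (suc zero)) (suc zero)       = edges-rotate (edges-rotate (edges-from-V₁ (suc (suc zero))))
    edges-oriented (suc (suc zero)) (suc (suc zero)) = edges-rotate (edges-rotate (edges-from-V₁ zero))

  orientation : ∀ a b → a ≢ b → b ≡ next a ⊎ a ≡ next b
  orientation zero             zero             a≢b = ⊥-elim (a≢b refl)
  orientation zero             (suc zero)       _   = inj₁ refl
  orientation zero             (suc (suc zero)) _   = inj₂ refl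
  orientation (suc zero)       zero             _   = inj₂ refl
  orientation (suc zero)       (suc zero)       a≢b = ⊥-elim (a≢b refl)
  orientation (suc zero)       (suc (suc zero)) _   = inj₁ refl
  orientation (suc (suc zero)) zero             _   = inj₁ refl
  orientation (suc (suc zero)) (suc zero)       _   = inj₂ refl
  orientation (suc (suc zero)) (suc (suc zero)) a≢b = ⊥-elim (a≢b refl)

  orient : ∀ {n} (P : Vertex n → Vertex n → Set) → (∀ {u v} → P v u → P u v) →
    (∀ a i j → P (a , i) (next a , j)) → ∀ u v → part u ≢ part v → P u v
  orient P swap oriented (a , i) (b , j) a≢b with orientation a b a≢b
  ... | inj₁ refl = oriented a i j
  ... | inj₂ refl = swap (oriented b j i)

  edges-separated : ∀ m (u v x y : Vertex (suc m)) → part u ≢ part v → part x ≢ part y →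
    EdgesSeparated (suc m) u v x y
  edges-separated m u v x y u≁v x≁y =
    orient (λ u v → EdgesSeparated (suc m) u v x y) edges-swapˡ
      (λ a i j → orient (EdgesSeparated (suc m) (a , i) (next a , j)) edges-swapʳ
                   (λ b _ _ → edges-oriented a b) x y x≁y)
      u v u≁v

open import Data.Nat using (_*_)
import Data.Rational as Q

lemma6 : (n : ℕ) (G : TripartiteGraph n) (u v x y : Vertex n)
    → TripartiteGraph.Edge G u v → TripartiteGraph.Edge G x y
    → ¬ (u ≡ x) → ¬ (u ≡ y) → ¬ (v ≡ x) → ¬ (v ≡ y)
    → ((s t : ℚ) → ¬ ((i : Fin 3) → onLine (p n u) (p n v) s i ≡ onLine (p n x) (p n y) t i))
      × ((s t : ℚ) → 1ℚ ≤ (+ (400 * n * n) / 1) Q.* distSq (onLine (p n u) (p n v) s) (onLine (p n x) (p n y) t))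
lemma6 zero    G (_ , ()) v x y uv xy u≢x u≢y v≢x v≢y
lemma6 (suc m) G u v x y uv xy u≢x u≢y v≢x v≢y = separated⇒disjoint lines , Separated.bound lines
  where
  open TripartiteGraph G using (independent)
  lines : Separated (scale (suc m)) (p (suc m) u) (p (suc m) v) (p (suc m) x) (p (suc m) y)
  lines = edges-separated m u v x y (independent uv) (independent xy) (u≢x , u≢y , v≢x , v≢y)
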